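{- Let $B\in M_n(\mathbb{Z})$ be a skew-symmetric integer matrix. Then for any $n\times n$ permutation matrix $P$, $\delta(PBP^t)\equiv\delta(B)\pmod 4$.
   Context: For a skew-symmetric $B=(b_{ij})\in M_n(\mathbb{Z})$, let $V(B)\in M_n(\mathbb{Z})$ be the matrix with $V(B)_{ij}=b_{ij}$ if $i<j$, $V(B)_{ii}=1$, and $V(B)_{ij}=0$ if $i>j$. Set $\mathfrak{S}(B):=V(B)+V(B)^t$ and $\delta(B):=\det(\mathfrak{S}(B))\pmod 4$. -}

module Defs where

open import Data.Nat.Base as ℕ using (ℕ; zero; suc)
open import Data.Integer.Base using (ℤ; +_; -_; _+_; _*_)
open import Data.Integer.DivMod using (_%ℕ_)
open import Data.Fin.Base using (Fin; zero; suc; punchIn; _<_)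
open import Data.Fin.Properties using (_≟_; _<?_)
open import Data.Fin.Permutation using (Permutation′; _⟨$⟩ʳ_)
open import Relation.Nullary.Decidable using (does)
open import Data.Bool.Base using (if_then_else_)
open import Relation.Binary.PropositionalEquality using (_≡_)

Mat : ℕ → Set
Mat n = Fin n → Fin n → ℤ

∑ : ∀ {n} → (Fin n → ℤ) → ℤ
∑ {zero}  f = + 0
∑ {suc n} f = f zero + ∑ (λ i → f (suc i))

transpose : ∀ {n} → Mat n → Mat n
transpose A i j = A j i

_·_ : ∀ {n} → Mat n → Mat n → Mat n
(A · C) i k = ∑ (λ j → A i j * C j k)

_⊕_ : ∀ {n} → Mat n → Mat n → Mat n
(A ⊕ C) i j = A i j + C i j

sgn : ℕ → ℤ
sgn zero          = + 1
sgn (suc zero)    = - (+ 1)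
sgn (suc (suc k)) = sgn k

-- determinant by Laplace (cofactor) expansion along the first row;
-- the minor deleting row 0 and column j is  λ r c → A (suc r) (punchIn j c)
det : ∀ {n} → Mat n → ℤ
det {zero}  A = + 1
det {suc n} A = ∑ (λ j → sgn (Data.Fin.Base.toℕ j) * (A zero j * det (λ r c → A (suc r) (punchIn j c))))

SkewSymmetric : ∀ {n} → Mat n → Set
SkewSymmetric B = ∀ i j → B i j ≡ - B j i

V : ∀ {n} → Mat n → Mat n
V B i j = if does (i <? j) then B i j else (if does (i ≟ j) then + 1 else + 0)

𝔖 : ∀ {n} → Mat n → Mat n
𝔖 B = V B ⊕ transpose (V B)

δ : ∀ {n} → Mat n → ℕ
δ B = det (𝔖 B) %ℕ 4

-- permutation matrix of σ : column j has its 1 in row σ(j)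
permMatrix : ∀ {n} → Permutation′ n → Mat n
permMatrix σ i j = if does (i ≟ (σ ⟨$⟩ʳ j)) then + 1 else + 0

{-# OPTIONS --safe #-}
-- Conjugation by a permutation matrix relabels indices, (P B Pᵗ) i j = B (σ⁻¹ i) (σ⁻¹ j), and det is
-- invariant under a simultaneous relabelling of rows and columns (a product of adjacent swaps, each
-- negating det twice). Undoing the relabelling turns 𝔖(P B Pᵗ) into a symmetric matrix with the same
-- diagonal as 𝔖(B) whose off-diagonal entries are ± the entries of B, so it agrees with 𝔖(B) modulo 2.
-- For symmetric matrices, adding 2d to a symmetric pair of off-diagonal entries changes det by a
-- multiple of 4, and replacing the pairs one at a time gives det 𝔖(P B Pᵗ) ≡ det 𝔖(B) (mod 4).
module Submission where

open import Defs
open import Data.Bool.Base using (if_then_else_)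
open import Data.Empty using (⊥-elim)
open import Data.Fin.Base using (Fin; zero; suc; punchIn; punchOut; toℕ; _<_)
open import Data.Fin.Permutation using (Permutation′; _⟨$⟩ʳ_; _⟨$⟩ˡ_; inverseˡ; inverseʳ; remove)
open import Data.Fin.Properties using (_≟_; _<?_; <-irrefl; <-asym; <-cmp; punchIn-punchOut; punchInᵢ≢i)
open import Data.Integer.Base using (ℤ; +_; +[1+_]; -[1+_]; -_; _+_; _*_; _%ℕ_; _/ℕ_)
open import Data.Integer.DivMod using (a≡a%ℕn+[a/ℕn]*n; n%ℕd<d)
import Data.Integer.Properties as ℤ
open import Data.Integer.Solver using (module +-*-Solver)
open import Data.List.Base using (List; []; _∷_; _++_; map; allFin; cartesianProduct)
open import Data.List.Membership.Propositional using (_∈_)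
open import Data.List.Membership.Propositional.Properties using (∈-allFin; ∈-cartesianProduct⁺)
open import Data.List.Relation.Unary.Any using (here; there)
open import Data.Nat.Base as ℕ using (ℕ)
import Data.Nat.Properties as ℕ
open import Data.Product using (∃-syntax; _×_; _,_; proj₁; proj₂)
open import Data.Sum as ⊎ using (_⊎_; inj₁; inj₂)
open import Function.Base using (_∘_)
open import Relation.Binary.Definitions using (tri<; tri≈; tri>)
open import Relation.Binary.PropositionalEquality
open import Relation.Nullary using (¬_; Dec; yes; no; does)
open import Relation.Nullary.Decidable using (dec-true; dec-false; _×-dec_; _⊎-dec_)
open +-*-Solver

infix 4 _≈_mod_
record _≈_mod_ (x y m : ℤ) : Set where
  constructor congruent
  field
    quotient : ℤ
    equation : x ≡ y + quotient * m

≡⇒≈-mod : ∀ {x y m} → x ≡ y → x ≈ y mod m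
≡⇒≈-mod {y = y} {m} refl = congruent (+ 0) (sym (trans (cong (_+_ y) (ℤ.*-zeroˡ m)) (ℤ.+-identityʳ y)))

≈-mod-sym : ∀ {x y m} → x ≈ y mod m → y ≈ x mod m
≈-mod-sym {x} {y} {m} (congruent k refl) = congruent (- k) (solve 3 (λ y k m → y := y :+ k :* m :+ (:- k) :* m) refl y k m)

≈-mod-trans : ∀ {x y z m} → x ≈ y mod m → y ≈ z mod m → x ≈ z mod m
≈-mod-trans {z = z} {m} (congruent k refl) (congruent l refl) =
  congruent (l + k) (solve 4 (λ z l k m → z :+ l :* m :+ k :* m := z :+ (l :+ k) :* m) refl z l k m)

r<d⇒r≢s+[1+m]*d : ∀ {r s d} m → r ℕ.< d → + r ≢ + s + +[1+ m ] * + d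
r<d⇒r≢s+[1+m]*d {r} {s} {d} m r<d eq = ℕ.<⇒≱ r<d (begin
  d                        ≤⟨ ℕ.m≤m+n d (m ℕ.* d) ⟩
  ℕ.suc m ℕ.* d            ≤⟨ ℕ.m≤n+m _ s ⟩
  s ℕ.+ ℕ.suc m ℕ.* d      ≡⟨ ℤ.+-injective (trans (cong (_+_ (+ s)) (ℤ.pos-* (ℕ.suc m) d)) (sym eq)) ⟩
  r                        ∎)
  where open ℕ.≤-Reasoning

remainder-unique : ∀ {r s d} t → r ℕ.< d → s ℕ.< d → + r ≡ + s + t * + d → r ≡ s
remainder-unique {s = s} (+ ℕ.zero) _ _ eq = ℤ.+-injective (trans eq (ℤ.+-identityʳ (+ s)))
remainder-unique +[1+ m ] r<d _ eq = ⊥-elim (r<d⇒r≢s+[1+m]*d m r<d eq)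
remainder-unique {r} {s} {d} -[1+ m ] _ s<d eq = ⊥-elim (r<d⇒r≢s+[1+m]*d m s<d (begin
  + s                                            ≡⟨ solve 3 (λ s p d → s := s :+ (:- p) :* d :+ p :* d) refl (+ s) +[1+ m ] (+ d) ⟩
  + s + -[1+ m ] * + d + +[1+ m ] * + d          ≡⟨ cong (_+ +[1+ m ] * + d) (sym eq) ⟩
  + r + +[1+ m ] * + d                           ∎))
  where open ≡-Reasoning

%ℕ-cong : ∀ {x y} d .{{_ : ℕ.NonZero d}} → x ≈ y mod + d → x %ℕ d ≡ y %ℕ d
%ℕ-cong {x} {y} d (congruent k x≡y+kd) = remainder-unique t (n%ℕd<d x d) (n%ℕd<d y d) (begin
  + rx                              ≡⟨ solve 3 (λ r q d → r := r :+ q :* d :+ :- (q :* d)) refl (+ rx) qx (+ d) ⟩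
  + rx + qx * + d + - (qx * + d)    ≡⟨ cong (_+ - (qx * + d)) (sym (a≡a%ℕn+[a/ℕn]*n x d)) ⟩
  x + - (qx * + d)                  ≡⟨ cong (λ z → z + - (qx * + d)) x≡y+kd ⟩
  y + k * + d + - (qx * + d)        ≡⟨ cong (λ z → z + k * + d + - (qx * + d)) (a≡a%ℕn+[a/ℕn]*n y d) ⟩
  + ry + qy * + d + k * + d + - (qx * + d)
    ≡⟨ solve 5 (λ r qy k qx d → r :+ qy :* d :+ k :* d :+ :- (qx :* d) := r :+ (qy :+ k :+ :- qx) :* d) refl (+ ry) qy k qx (+ d) ⟩
  + ry + t * + d                    ∎)
  where
  open ≡-Reasoning
  rx = x %ℕ d
  ry = y %ℕ d
  qx = x /ℕ d
  qy = y /ℕ d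
  t = qy + k + - qx

∑-cong : ∀ {n} {f g : Fin n → ℤ} → (∀ i → f i ≡ g i) → ∑ f ≡ ∑ g
∑-cong {ℕ.zero}  _   = refl
∑-cong {ℕ.suc n} f≗g = cong₂ _+_ (f≗g zero) (∑-cong (f≗g ∘ suc))

∑-zero : ∀ {n} {f : Fin n → ℤ} → (∀ i → f i ≡ + 0) → ∑ f ≡ + 0
∑-zero {ℕ.zero}  _   = refl
∑-zero {ℕ.suc n} f≗0 = cong₂ _+_ (f≗0 zero) (∑-zero (f≗0 ∘ suc))

∑-distrib-+ : ∀ {n} (f g : Fin n → ℤ) → ∑ (λ i → f i + g i) ≡ ∑ f + ∑ g
∑-distrib-+ {ℕ.zero}  f g = refl
∑-distrib-+ {ℕ.suc n} f g = trans
  (cong (_+_ (f zero + g zero)) (∑-distrib-+ (f ∘ suc) (g ∘ suc)))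
  (solve 4 (λ a b c d → a :+ b :+ (c :+ d) := a :+ c :+ (b :+ d)) refl (f zero) (g zero) (∑ (f ∘ suc)) (∑ (g ∘ suc)))

*-distribˡ-∑ : ∀ {n} (c : ℤ) (f : Fin n → ℤ) → c * ∑ f ≡ ∑ (λ i → c * f i)
*-distribˡ-∑ {ℕ.zero}  c f = ℤ.*-zeroʳ c
*-distribˡ-∑ {ℕ.suc n} c f = trans (ℤ.*-distribˡ-+ c (f zero) _) (cong (_+_ (c * f zero)) (*-distribˡ-∑ c (f ∘ suc)))

neg-distrib-∑ : ∀ {n} (f : Fin n → ℤ) → - ∑ f ≡ ∑ (λ i → - f i)
neg-distrib-∑ {ℕ.zero}  f = refl
neg-distrib-∑ {ℕ.suc n} f = trans (ℤ.neg-distrib-+ (f zero) _) (cong (_+_ (- f zero)) (neg-distrib-∑ (f ∘ suc)))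

∑-comm : ∀ {m n} (f : Fin m → Fin n → ℤ) → ∑ (λ i → ∑ (λ j → f i j)) ≡ ∑ (λ j → ∑ (λ i → f i j))
∑-comm {ℕ.zero} {n} f = sym (∑-zero {n} {λ _ → + 0} (λ _ → refl))
∑-comm {ℕ.suc m} f = trans
  (cong (_+_ (∑ (f zero))) (∑-comm (f ∘ suc)))
  (sym (∑-distrib-+ (f zero) (λ j → ∑ (λ i → f (suc i) j))))

∑-remove : ∀ {n} (j : Fin (ℕ.suc n)) (f : Fin (ℕ.suc n) → ℤ) → ∑ f ≡ f j + ∑ (f ∘ punchIn j)
∑-remove zero f = refl
∑-remove {ℕ.suc n} (suc j) f = trans
  (cong (_+_ (f zero)) (∑-remove j (f ∘ suc)))
  (solve 3 (λ a b c → a :+ (b :+ c) := b :+ (a :+ c)) refl (f zero) (f (suc j)) _)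

adjSwap : ∀ {m} → Fin m → Fin (ℕ.suc m) → Fin (ℕ.suc m)
adjSwap zero    zero          = suc zero
adjSwap zero    (suc zero)    = zero
adjSwap zero    (suc (suc i)) = suc (suc i)
adjSwap (suc k) zero          = zero
adjSwap (suc k) (suc i)       = suc (adjSwap k i)

adjSwap-involutive : ∀ {m} (k : Fin m) i → adjSwap k (adjSwap k i) ≡ i
adjSwap-involutive zero    zero          = refl
adjSwap-involutive zero    (suc zero)    = refl
adjSwap-involutive zero    (suc (suc i)) = refl
adjSwap-involutive (suc k) zero          = refl
adjSwap-involutive (suc k) (suc i)       = cong suc (adjSwap-involutive k i)

adjSwap-injective : ∀ {m} (k : Fin m) {i j} → adjSwap k i ≡ adjSwap k j → i ≡ j
adjSwap-injective k {i} {j} eq = trans (sym (adjSwap-involutive k i)) (trans (cong (adjSwap k) eq) (adjSwap-involutive k j))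

∑-adjSwap : ∀ {m} (k : Fin m) (f : Fin (ℕ.suc m) → ℤ) → ∑ f ≡ ∑ (f ∘ adjSwap k)
∑-adjSwap zero    f = solve 3 (λ a b c → a :+ (b :+ c) := b :+ (a :+ c)) refl (f zero) (f (suc zero)) _
∑-adjSwap (suc k) f = cong (_+_ (f zero)) (∑-adjSwap k (f ∘ suc))

applySwaps : ∀ {m} → List (Fin m) → Fin (ℕ.suc m) → Fin (ℕ.suc m)
applySwaps []      i = i
applySwaps (k ∷ w) i = applySwaps w (adjSwap k i)

applySwaps-++ : ∀ {m} (w v : List (Fin m)) i → applySwaps (w ++ v) i ≡ applySwaps v (applySwaps w i)
applySwaps-++ []      v i = refl
applySwaps-++ (k ∷ w) v i = applySwaps-++ w v (adjSwap k i)

applySwaps-injective : ∀ {m} (w : List (Fin m)) {i j} → applySwaps w i ≡ applySwaps w j → i ≡ j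
applySwaps-injective []      eq = eq
applySwaps-injective (k ∷ w) eq = adjSwap-injective k (applySwaps-injective w eq)

applySwaps-map-suc-zero : ∀ {m} (w : List (Fin m)) → applySwaps (map suc w) zero ≡ zero
applySwaps-map-suc-zero []      = refl
applySwaps-map-suc-zero (k ∷ w) = applySwaps-map-suc-zero w

applySwaps-map-suc-suc : ∀ {m} (w : List (Fin m)) i → applySwaps (map suc w) (suc i) ≡ suc (applySwaps w i)
applySwaps-map-suc-suc []      i = refl
applySwaps-map-suc-suc (k ∷ w) i = applySwaps-map-suc-suc w (adjSwap k i)

rotation : ∀ {m} → Fin (ℕ.suc m) → List (Fin m)
rotation zero              = []
rotation {ℕ.suc m} (suc k) = zero ∷ map suc (rotation k)

rotation-zero : ∀ {m} (k : Fin (ℕ.suc m)) → applySwaps (rotation k) zero ≡ k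
rotation-zero zero              = refl
rotation-zero {ℕ.suc m} (suc k) = trans (applySwaps-map-suc-suc (rotation k) zero) (cong suc (rotation-zero k))

rotation-suc : ∀ {m} (k : Fin (ℕ.suc m)) i → applySwaps (rotation k) (suc i) ≡ punchIn k i
rotation-suc zero              i       = refl
rotation-suc {ℕ.suc m} (suc k) zero    = applySwaps-map-suc-zero (rotation k)
rotation-suc {ℕ.suc m} (suc k) (suc i) = trans (applySwaps-map-suc-suc (rotation k) (suc i)) (cong suc (rotation-suc k i))

liftThenRotate : ∀ {m} → Fin (ℕ.suc (ℕ.suc m)) → List (Fin m) → List (Fin (ℕ.suc m))
liftThenRotate k v = map suc v ++ rotation k

liftThenRotate-zero : ∀ {m} (k : Fin (ℕ.suc (ℕ.suc m))) v → applySwaps (liftThenRotate k v) zero ≡ k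
liftThenRotate-zero k v = begin
  applySwaps (map suc v ++ rotation k) zero             ≡⟨ applySwaps-++ (map suc v) (rotation k) zero ⟩
  applySwaps (rotation k) (applySwaps (map suc v) zero) ≡⟨ cong (applySwaps (rotation k)) (applySwaps-map-suc-zero v) ⟩
  applySwaps (rotation k) zero                          ≡⟨ rotation-zero k ⟩
  k                                                     ∎
  where open ≡-Reasoning

liftThenRotate-suc : ∀ {m} (k : Fin (ℕ.suc (ℕ.suc m))) v i →
                     applySwaps (liftThenRotate k v) (suc i) ≡ punchIn k (applySwaps v i)
liftThenRotate-suc k v i = begin
  applySwaps (map suc v ++ rotation k) (suc i)             ≡⟨ applySwaps-++ (map suc v) (rotation k) (suc i) ⟩
  applySwaps (rotation k) (applySwaps (map suc v) (suc i)) ≡⟨ cong (applySwaps (rotation k)) (applySwaps-map-suc-suc v i) ⟩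
  applySwaps (rotation k) (suc (applySwaps v i))           ≡⟨ rotation-suc k (applySwaps v i) ⟩
  punchIn k (applySwaps v i)                               ∎
  where open ≡-Reasoning

permutation-as-swaps : ∀ {m} (π : Permutation′ (ℕ.suc m)) → ∃[ w ] (∀ i → π ⟨$⟩ʳ i ≡ applySwaps w i)
permutation-as-swaps {ℕ.zero} π = [] , λ { zero → only-zero (π ⟨$⟩ʳ zero) }
  where
  only-zero : (x : Fin 1) → x ≡ zero
  only-zero zero = refl
permutation-as-swaps {ℕ.suc m} π = liftThenRotate (π ⟨$⟩ʳ zero) v , agree
  where
  ρ = remove zero π
  v = proj₁ (permutation-as-swaps ρ)
  agree : ∀ i → π ⟨$⟩ʳ i ≡ applySwaps (liftThenRotate (π ⟨$⟩ʳ zero) v) i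
  agree zero    = sym (liftThenRotate-zero (π ⟨$⟩ʳ zero) v)
  agree (suc i) = sym (begin
    applySwaps (liftThenRotate (π ⟨$⟩ʳ zero) v) (suc i) ≡⟨ liftThenRotate-suc (π ⟨$⟩ʳ zero) v i ⟩
    punchIn (π ⟨$⟩ʳ zero) (applySwaps v i)             ≡⟨ cong (punchIn (π ⟨$⟩ʳ zero)) (sym (proj₂ (permutation-as-swaps ρ) i)) ⟩
    punchIn (π ⟨$⟩ʳ zero) (ρ ⟨$⟩ʳ i)                   ≡⟨ punchIn-punchOut _ ⟩
    π ⟨$⟩ʳ suc i                                       ∎)
    where open ≡-Reasoning

swaps-to-pair : ∀ {m} {a b : Fin (ℕ.suc (ℕ.suc m))} (a≢b : a ≢ b) →
                ∃[ w ] (applySwaps w zero ≡ a × applySwaps w (suc zero) ≡ b)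
swaps-to-pair {a = a} {b} a≢b = liftThenRotate a (rotation b′) , liftThenRotate-zero a (rotation b′) , (begin
  applySwaps (liftThenRotate a (rotation b′)) (suc zero) ≡⟨ liftThenRotate-suc a (rotation b′) zero ⟩
  punchIn a (applySwaps (rotation b′) zero)              ≡⟨ cong (punchIn a) (rotation-zero b′) ⟩
  punchIn a b′                                           ≡⟨ punchIn-punchOut a≢b ⟩
  b                                                      ∎)
  where
  open ≡-Reasoning
  b′ = punchOut a≢b

det-cong : ∀ {n} {A C : Mat n} → (∀ i j → A i j ≡ C i j) → det A ≡ det C
det-cong {ℕ.zero}  _   = refl
det-cong {ℕ.suc n} A≗C = ∑-cong (λ j → cong₂ (λ x y → sgn (toℕ j) * (x * y))
  (A≗C zero j) (det-cong (λ r c → A≗C (suc r) (punchIn j c))))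

sgn-suc : ∀ k → sgn (ℕ.suc k) ≡ - sgn k
sgn-suc ℕ.zero    = refl
sgn-suc (ℕ.suc k) = trans (sym (ℤ.neg-involutive (sgn k))) (cong -_ (sym (sgn-suc k)))

-- How the first-row Laplace term at column adjSwap k j of the column-swapped matrix relates to the term at column j.
data AdjSwapMinor : ∀ {m} → Fin m → Fin (ℕ.suc m) → Set where
  touching : ∀ {m} {k : Fin m} {j} → sgn (toℕ (adjSwap k j)) ≡ - sgn (toℕ j) →
             (∀ c → adjSwap k (punchIn (adjSwap k j) c) ≡ punchIn j c) → AdjSwapMinor k j
  avoiding : ∀ {m} {k : Fin (ℕ.suc m)} {j} (k′ : Fin m) → sgn (toℕ (adjSwap k j)) ≡ sgn (toℕ j) →
             (∀ c → adjSwap k (punchIn (adjSwap k j) c) ≡ punchIn j (adjSwap k′ c)) → AdjSwapMinor k j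

adjSwapMinor : ∀ {m} (k : Fin m) (j : Fin (ℕ.suc m)) → AdjSwapMinor k j
adjSwapMinor zero zero                      = touching refl λ { zero → refl ; (suc c) → refl }
adjSwapMinor zero (suc zero)                = touching refl λ { zero → refl ; (suc c) → refl }
adjSwapMinor zero (suc (suc zero))          = avoiding zero refl λ { zero → refl ; (suc zero) → refl ; (suc (suc c)) → refl }
adjSwapMinor zero (suc (suc (suc j)))       = avoiding zero refl λ { zero → refl ; (suc zero) → refl ; (suc (suc c)) → refl }
adjSwapMinor (suc k) zero                   = avoiding k refl λ c → refl
adjSwapMinor (suc k) (suc j) with adjSwapMinor k j
... | touching s e = touching
  (trans (sgn-suc (toℕ (adjSwap k j))) (trans (cong -_ s) (cong -_ (sym (sgn-suc (toℕ j))))))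
  λ { zero → refl ; (suc c) → cong suc (e c) }
... | avoiding k′ s e = avoiding (suc k′)
  (trans (sgn-suc (toℕ (adjSwap k j))) (trans (cong -_ s) (sym (sgn-suc (toℕ j)))))
  λ { zero → refl ; (suc c) → cong suc (e c) }

det-swapColumns : ∀ {m} (k : Fin m) (A : Mat (ℕ.suc m)) → det (λ i j → A i (adjSwap k j)) ≡ - det A
det-swapColumns {m} k A = begin
  ∑ term′                    ≡⟨ ∑-adjSwap k term′ ⟩
  ∑ (term′ ∘ adjSwap k)      ≡⟨ ∑-cong reindexed ⟩
  ∑ (λ j → - term j)         ≡⟨ sym (neg-distrib-∑ term) ⟩
  - ∑ term                   ∎
  where
  open ≡-Reasoning
  swappedMinor : Fin (ℕ.suc m) → Mat m
  swappedMinor j r c = A (suc r) (adjSwap k (punchIn j c))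
  term term′ : Fin (ℕ.suc m) → ℤ
  term j = sgn (toℕ j) * (A zero j * det (λ r c → A (suc r) (punchIn j c)))
  term′ j = sgn (toℕ j) * (A zero (adjSwap k j) * det (swappedMinor j))
  reindexed : ∀ j → term′ (adjSwap k j) ≡ - term j
  reindexed j with adjSwapMinor k j
  ... | touching s e = begin
    term′ (adjSwap k j)
      ≡⟨ cong₂ (λ x y → x * (A zero y * det (swappedMinor (adjSwap k j)))) s (adjSwap-involutive k j) ⟩
    - sgn (toℕ j) * (A zero j * det (λ r c → A (suc r) (adjSwap k (punchIn (adjSwap k j) c))))
      ≡⟨ cong (λ z → - sgn (toℕ j) * (A zero j * z)) (det-cong (λ r c → cong (A (suc r)) (e c))) ⟩
    - sgn (toℕ j) * (A zero j * det (λ r c → A (suc r) (punchIn j c)))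
      ≡⟨ sym (ℤ.neg-distribˡ-* (sgn (toℕ j)) _) ⟩
    - term j ∎
  ... | avoiding k′ s e = begin
    term′ (adjSwap k j)
      ≡⟨ cong₂ (λ x y → x * (A zero y * det (swappedMinor (adjSwap k j)))) s (adjSwap-involutive k j) ⟩
    sgn (toℕ j) * (A zero j * det (λ r c → A (suc r) (adjSwap k (punchIn (adjSwap k j) c))))
      ≡⟨ cong (λ z → sgn (toℕ j) * (A zero j * z))
           (trans (det-cong (λ r c → cong (A (suc r)) (e c))) (det-swapColumns k′ (λ r c → A (suc r) (punchIn j c)))) ⟩
    sgn (toℕ j) * (A zero j * - det (λ r c → A (suc r) (punchIn j c)))
      ≡⟨ solve 3 (λ a b c → a :* (b :* (:- c)) := :- (a :* (b :* c))) refl (sgn (toℕ j)) (A zero j) _ ⟩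
    - term j ∎

det-expand-column₀ : ∀ {n} (A : Mat (ℕ.suc n)) →
                     det A ≡ ∑ (λ i → sgn (toℕ i) * (A i zero * det (λ r c → A (punchIn i r) (suc c))))
det-expand-column₀ {ℕ.zero}  A = refl
det-expand-column₀ {ℕ.suc n} A = cong (_+_ (sgn 0 * (A zero zero * det D₀₀))) (begin
  ∑ (λ j → sgn (toℕ (suc j)) * (A zero (suc j) * det (λ r c → A (suc r) (punchIn (suc j) c))))
    ≡⟨ ∑-cong (λ j → cong (λ z → sgn (toℕ (suc j)) * (A zero (suc j) * z))
                          (det-expand-column₀ (λ r c → A (suc r) (punchIn (suc j) c)))) ⟩
  ∑ (λ j → sgn (toℕ (suc j)) * (A zero (suc j) * ∑ (λ i → sgn (toℕ i) * (A (suc i) zero * det (D i j)))))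
    ≡⟨ ∑-cong (λ j → pull (sgn (toℕ (suc j))) (A zero (suc j)) (λ i → sgn (toℕ i) * (A (suc i) zero * det (D i j)))) ⟩
  ∑ (λ j → ∑ (λ i → rowFirst i j))   ≡⟨ sym (∑-comm rowFirst) ⟩
  ∑ (λ i → ∑ (λ j → rowFirst i j))   ≡⟨ ∑-cong (λ i → ∑-cong (reorder i)) ⟩
  ∑ (λ i → ∑ (λ j → columnFirst i j))
    ≡⟨ ∑-cong (λ i → sym (pull (sgn (toℕ (suc i))) (A (suc i) zero) (λ j → sgn (toℕ j) * (A zero (suc j) * det (D i j))))) ⟩
  ∑ (λ i → sgn (toℕ (suc i)) * (A (suc i) zero * ∑ (λ j → sgn (toℕ j) * (A zero (suc j) * det (D i j))))) ∎)
  where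
  open ≡-Reasoning
  D₀₀ : Mat (ℕ.suc n)
  D₀₀ r c = A (suc r) (suc c)
  D : Fin (ℕ.suc n) → Fin (ℕ.suc n) → Mat n
  D i j r c = A (suc (punchIn i r)) (suc (punchIn j c))
  rowFirst columnFirst : Fin (ℕ.suc n) → Fin (ℕ.suc n) → ℤ
  rowFirst i j = sgn (toℕ (suc j)) * (A zero (suc j) * (sgn (toℕ i) * (A (suc i) zero * det (D i j))))
  columnFirst i j = sgn (toℕ (suc i)) * (A (suc i) zero * (sgn (toℕ j) * (A zero (suc j) * det (D i j))))
  pull : ∀ {k} (s x : ℤ) (g : Fin k → ℤ) → s * (x * ∑ g) ≡ ∑ (λ i → s * (x * g i))
  pull s x g = trans (cong (s *_) (*-distribˡ-∑ x g)) (*-distribˡ-∑ s (λ i → x * g i))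
  reorder : ∀ i j → rowFirst i j ≡ columnFirst i j
  reorder i j rewrite sgn-suc (toℕ j) | sgn-suc (toℕ i) =
    solve 5 (λ sj a si b d → (:- sj) :* (a :* (si :* (b :* d))) := (:- si) :* (b :* (sj :* (a :* d)))) refl
      (sgn (toℕ j)) (A zero (suc j)) (sgn (toℕ i)) (A (suc i) zero) (det (D i j))

det-transpose : ∀ {n} (A : Mat n) → det (transpose A) ≡ det A
det-transpose {ℕ.zero}  A = refl
det-transpose {ℕ.suc n} A = trans
  (∑-cong (λ j → cong (λ z → sgn (toℕ j) * (A j zero * z)) (det-transpose (λ r c → A (punchIn j r) (suc c)))))
  (sym (det-expand-column₀ A))

det-swapRows : ∀ {m} (k : Fin m) (A : Mat (ℕ.suc m)) → det (λ i j → A (adjSwap k i) j) ≡ - det A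
det-swapRows k A = begin
  det (λ i j → A (adjSwap k i) j)               ≡⟨ sym (det-transpose (λ i j → A (adjSwap k i) j)) ⟩
  det (λ i j → transpose A i (adjSwap k j))     ≡⟨ det-swapColumns k (transpose A) ⟩
  - det (transpose A)                           ≡⟨ cong -_ (det-transpose A) ⟩
  - det A                                       ∎
  where open ≡-Reasoning

det-conj-adjSwap : ∀ {m} (k : Fin m) (A : Mat (ℕ.suc m)) → det (λ i j → A (adjSwap k i) (adjSwap k j)) ≡ det A
det-conj-adjSwap k A = trans (det-swapRows k (λ i j → A i (adjSwap k j)))
  (trans (cong -_ (det-swapColumns k A)) (ℤ.neg-involutive (det A)))

det-conj-swaps : ∀ {m} (w : List (Fin m)) (A : Mat (ℕ.suc m)) →
                 det (λ i j → A (applySwaps w i) (applySwaps w j)) ≡ det A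
det-conj-swaps []      A = refl
det-conj-swaps (k ∷ w) A = trans
  (det-conj-adjSwap k (λ i j → A (applySwaps w i) (applySwaps w j)))
  (det-conj-swaps w A)

det-conj-permutation : ∀ {n} (π : Permutation′ n) (A : Mat n) → det (λ i j → A (π ⟨$⟩ʳ i) (π ⟨$⟩ʳ j)) ≡ det A
det-conj-permutation {ℕ.zero}  π A = refl
det-conj-permutation {ℕ.suc m} π A = trans
  (det-cong (λ i j → cong₂ A (proj₂ (permutation-as-swaps π) i) (proj₂ (permutation-as-swaps π) j)))
  (det-conj-swaps (proj₁ (permutation-as-swaps π)) A)

det-perturb-row₀ : ∀ {n} (X Y : Mat (ℕ.suc n)) (j : Fin (ℕ.suc n)) (e : ℤ) →
                   (∀ r c → Y (suc r) c ≡ X (suc r) c) → (∀ c → Y zero (punchIn j c) ≡ X zero (punchIn j c)) →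
                   Y zero j ≡ X zero j + e → det Y ≡ det X + e * (sgn (toℕ j) * det (λ r c → X (suc r) (punchIn j c)))
det-perturb-row₀ {n} X Y j e rows≡ row₀≡ entry = begin
  det Y                                    ≡⟨ ∑-remove j (term Y) ⟩
  term Y j + ∑ (term Y ∘ punchIn j)
    ≡⟨ cong₂ _+_ (cong₂ (λ u v → sgn (toℕ j) * (u * v)) entry (minors≡ j)) (∑-cong others) ⟩
  sgn (toℕ j) * ((X zero j + e) * Dj) + ∑ (term X ∘ punchIn j)
    ≡⟨ solve 5 (λ s x e d r → s :* ((x :+ e) :* d) :+ r := s :* (x :* d) :+ r :+ e :* (s :* d)) refl
         (sgn (toℕ j)) (X zero j) e Dj (∑ (term X ∘ punchIn j)) ⟩
  term X j + ∑ (term X ∘ punchIn j) + e * (sgn (toℕ j) * Dj)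
                                           ≡⟨ cong (_+ e * (sgn (toℕ j) * Dj)) (sym (∑-remove j (term X))) ⟩
  det X + e * (sgn (toℕ j) * Dj)           ∎
  where
  open ≡-Reasoning
  term : Mat (ℕ.suc n) → Fin (ℕ.suc n) → ℤ
  term Z k = sgn (toℕ k) * (Z zero k * det (λ r c → Z (suc r) (punchIn k c)))
  Dj = det (λ r c → X (suc r) (punchIn j c))
  minors≡ : ∀ k → det (λ r c → Y (suc r) (punchIn k c)) ≡ det (λ r c → X (suc r) (punchIn k c))
  minors≡ k = det-cong (λ r c → rows≡ r (punchIn k c))
  others : ∀ c → term Y (punchIn j c) ≡ term X (punchIn j c)
  others c = cong₂ (λ u v → sgn (toℕ (punchIn j c)) * (u * v)) (row₀≡ c) (minors≡ (punchIn j c))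

Symmetric : ∀ {n} → Mat n → Set
Symmetric M = ∀ i j → M i j ≡ M j i

set₀₁ : ∀ {m} → Mat (ℕ.suc (ℕ.suc m)) → ℤ → Mat (ℕ.suc (ℕ.suc m))
set₀₁ M y zero zero          = M zero zero
set₀₁ M y zero (suc zero)    = y
set₀₁ M y zero (suc (suc j)) = M zero (suc (suc j))
set₀₁ M y (suc i) j          = M (suc i) j

set₁₀ : ∀ {m} → Mat (ℕ.suc (ℕ.suc m)) → ℤ → Mat (ℕ.suc (ℕ.suc m))
set₁₀ M y zero j                = M zero j
set₁₀ M y (suc zero) zero       = y
set₁₀ M y (suc zero) (suc j)    = M (suc zero) (suc j)
set₁₀ M y (suc (suc i)) j       = M (suc (suc i)) j

-- Each of the two single-entry changes by e = 2d adds e times a cofactor; by symmetry the two cofactors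
-- differ only by e times a smaller minor, so the total change -2eC - e²D is divisible by 4.
det-symmetricUpdate₀₁ : ∀ {m} (M : Mat (ℕ.suc (ℕ.suc m))) → Symmetric M → ∀ {y} →
                        y ≈ M zero (suc zero) mod + 2 → det (set₀₁ (set₁₀ M y) y) ≈ det M mod + 4
det-symmetricUpdate₀₁ {m} M symM {y} (congruent d y≡) = congruent (- (d * C) + - (d * (d * D))) (begin
  det (set₀₁ L y)                                 ≡⟨ update₀₁ L y≡ ⟩
  det L + e * (sgn 1 * det (minor L))
    ≡⟨ cong₂ (λ u v → u + e * (sgn 1 * v)) (trans L-as-update₀₁ (update₀₁ M y≡)) minor-L ⟩
  det M + e * (sgn 1 * C) + e * (sgn 1 * (C + e * (sgn 0 * D)))
    ≡⟨ solve 4 (λ x d c dd → x :+ (d :* con (+ 2)) :* (con (- (+ 1)) :* c)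
                               :+ (d :* con (+ 2)) :* (con (- (+ 1)) :* (c :+ (d :* con (+ 2)) :* (con (+ 1) :* dd)))
                           := x :+ (:- (d :* c) :+ :- (d :* (d :* dd))) :* con (+ 4)) refl (det M) d C D ⟩
  det M + (- (d * C) + - (d * (d * D))) * + 4     ∎)
  where
  open ≡-Reasoning
  e = d * + 2
  minor : Mat (ℕ.suc (ℕ.suc m)) → Mat (ℕ.suc m)
  minor X r c = X (suc r) (punchIn (suc zero) c)
  L = set₁₀ M y
  C = det (minor M)
  D = det (λ r c → minor M (suc r) (punchIn zero c))
  update₀₁ : ∀ X → y ≡ X zero (suc zero) + e → det (set₀₁ X y) ≡ det X + e * (sgn 1 * det (minor X))
  update₀₁ X = det-perturb-row₀ X (set₀₁ X y) (suc zero) e (λ r c → refl) (λ { zero → refl ; (suc c) → refl })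
  transpose-L : ∀ i j → transpose L i j ≡ set₀₁ M y i j
  transpose-L zero          zero          = refl
  transpose-L zero          (suc zero)    = refl
  transpose-L zero          (suc (suc j)) = symM _ _
  transpose-L (suc zero)    zero          = symM _ _
  transpose-L (suc (suc i)) zero          = symM _ _
  transpose-L (suc i)       (suc zero)    = symM _ _
  transpose-L (suc i)       (suc (suc j)) = symM _ _
  L-as-update₀₁ : det L ≡ det (set₀₁ M y)
  L-as-update₀₁ = trans (sym (det-transpose L)) (det-cong transpose-L)
  minor-L : det (minor L) ≡ C + e * (sgn 0 * D)
  minor-L = det-perturb-row₀ (minor M) (minor L) zero e (λ r c → refl) (λ c → refl) (trans y≡ (cong (_+ e) (symM _ _)))

IsPair : ∀ {n} → Fin n → Fin n → Fin n → Fin n → Set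
IsPair a b i j = (i ≡ a × j ≡ b) ⊎ (i ≡ b × j ≡ a)

isPair? : ∀ {n} (a b i j : Fin n) → Dec (IsPair a b i j)
isPair? a b i j = (i ≟ a ×-dec j ≟ b) ⊎-dec (i ≟ b ×-dec j ≟ a)

IsPair-swap : ∀ {n} {a b i j : Fin n} → IsPair a b i j → IsPair a b j i
IsPair-swap (inj₁ (i≡a , j≡b)) = inj₂ (j≡b , i≡a)
IsPair-swap (inj₂ (i≡b , j≡a)) = inj₁ (j≡a , i≡b)

setPair : ∀ {n} → Mat n → Fin n → Fin n → ℤ → Mat n
setPair X a b y i j = if does (isPair? a b i j) then y else X i j

setPair-on : ∀ {n} (X : Mat n) {a b y i j} → IsPair a b i j → setPair X a b y i j ≡ y
setPair-on X {a} {b} {y} {i} {j} p = cong (λ c → if c then y else X i j) (dec-true (isPair? a b i j) p)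

setPair-off : ∀ {n} (X : Mat n) {a b y i j} → ¬ IsPair a b i j → setPair X a b y i j ≡ X i j
setPair-off X {a} {b} {y} {i} {j} ¬p = cong (λ c → if c then y else X i j) (dec-false (isPair? a b i j) ¬p)

setPair-symmetric : ∀ {n} (X : Mat n) → Symmetric X → ∀ a b y → Symmetric (setPair X a b y)
setPair-symmetric X symX a b y i j with isPair? a b i j
... | yes p  = trans (setPair-on X p) (sym (setPair-on X (IsPair-swap p)))
... | no ¬p = trans (setPair-off X ¬p) (trans (symX i j) (sym (setPair-off X (¬p ∘ IsPair-swap))))

setPair-unchanged : ∀ {n} (X : Mat n) → Symmetric X → ∀ {a b y} → y ≡ X a b → ∀ i j → setPair X a b y i j ≡ X i j
setPair-unchanged X symX {a} {b} y≡ i j with isPair? a b i j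
... | yes p@(inj₁ (refl , refl)) = trans (setPair-on X p) y≡
... | yes p@(inj₂ (refl , refl)) = trans (setPair-on X p) (trans y≡ (symX a b))
... | no ¬p                      = setPair-off X ¬p

det-setPair : ∀ {n} (X : Mat n) → Symmetric X → ∀ {a b y} → a ≢ b → y ≈ X a b mod + 2 →
              det (setPair X a b y) ≈ det X mod + 4
det-setPair {ℕ.suc ℕ.zero} X _ {zero} {zero} a≢b _ = ⊥-elim (a≢b refl)
det-setPair {ℕ.suc (ℕ.suc m)} X symX {a} {b} {y} a≢b y≈ = congruent k (begin
  det (setPair X a b y)                        ≡⟨ sym (det-conj-swaps w (setPair X a b y)) ⟩
  det (λ i j → setPair X a b y (τ i) (τ j))    ≡⟨ det-cong moved ⟩
  det (set₀₁ (set₁₀ Y y) y)                    ≡⟨ _≈_mod_.equation atFront ⟩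
  det Y + k * + 4                              ≡⟨ cong (_+ k * + 4) (det-conj-swaps w X) ⟩
  det X + k * + 4                              ∎)
  where
  open ≡-Reasoning
  w = proj₁ (swaps-to-pair a≢b)
  τ = applySwaps w
  τ₀ : τ zero ≡ a
  τ₀ = proj₁ (proj₂ (swaps-to-pair a≢b))
  τ₁ : τ (suc zero) ≡ b
  τ₁ = proj₂ (proj₂ (swaps-to-pair a≢b))
  Y : Mat (ℕ.suc (ℕ.suc m))
  Y i j = X (τ i) (τ j)
  atFront = det-symmetricUpdate₀₁ Y (λ i j → symX (τ i) (τ j))
              (subst (λ z → y ≈ z mod + 2) (sym (cong₂ X τ₀ τ₁)) y≈)
  k = _≈_mod_.quotient atFront
  preimage : ∀ {i i₀ c} → τ i₀ ≡ c → τ i ≡ c → i ≡ i₀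
  preimage τi₀≡c τi≡c = applySwaps-injective w (trans τi≡c (sym τi₀≡c))
  away : ∀ {i j} → ¬ IsPair zero (suc zero) i j → setPair X a b y (τ i) (τ j) ≡ Y i j
  away ¬p = setPair-off X λ
    { (inj₁ (τi≡a , τj≡b)) → ¬p (inj₁ (preimage τ₀ τi≡a , preimage τ₁ τj≡b))
    ; (inj₂ (τi≡b , τj≡a)) → ¬p (inj₂ (preimage τ₁ τi≡b , preimage τ₀ τj≡a)) }
  moved : ∀ i j → setPair X a b y (τ i) (τ j) ≡ set₀₁ (set₁₀ Y y) y i j
  moved zero          zero          = away λ { (inj₁ (_ , ())) ; (inj₂ (() , _)) }
  moved zero          (suc zero)    = setPair-on X (inj₁ (τ₀ , τ₁))
  moved zero          (suc (suc j)) = away λ { (inj₁ (_ , ())) ; (inj₂ (() , _)) }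
  moved (suc zero)    zero          = setPair-on X (inj₂ (τ₁ , τ₀))
  moved (suc zero)    (suc j)       = away λ { (inj₁ (() , _)) ; (inj₂ (_ , ())) }
  moved (suc (suc i)) j             = away λ { (inj₁ (() , _)) ; (inj₂ (() , _)) }

det-≈-mod4 : ∀ {n} {M M′ : Mat n} → Symmetric M → Symmetric M′ → (∀ a → M′ a a ≡ M a a) →
             (∀ a b → M′ a b ≈ M a b mod + 2) → det M′ ≈ det M mod + 4
det-≈-mod4 {n} {M} {M′} symM symM′ diag off =
  ≈-mod-trans (≡⇒≈-mod (det-cong (λ i j → sym (updates-complete allPairs (∈-allPairs i j))))) (det-updates allPairs)
  where
  allPairs = cartesianProduct (allFin n) (allFin n)
  ∈-allPairs : ∀ i j → (i , j) ∈ allPairs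
  ∈-allPairs i j = ∈-cartesianProduct⁺ (∈-allFin i) (∈-allFin j)
  updates : List (Fin n × Fin n) → Mat n
  updates []             = M
  updates ((a , b) ∷ ps) = setPair (updates ps) a b (M′ a b)
  updates-symmetric : ∀ ps → Symmetric (updates ps)
  updates-symmetric []             = symM
  updates-symmetric ((a , b) ∷ ps) = setPair-symmetric (updates ps) (updates-symmetric ps) a b (M′ a b)
  target-entry : ∀ X {a b i j} → IsPair a b i j → setPair X a b (M′ a b) i j ≡ M′ i j
  target-entry X p@(inj₁ (refl , refl)) = setPair-on X p
  target-entry X p@(inj₂ (refl , refl)) = trans (setPair-on X p) (symM′ _ _)
  updates-entry : ∀ ps i j → updates ps i j ≡ M i j ⊎ updates ps i j ≡ M′ i j
  updates-entry []             i j = inj₁ refl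
  updates-entry ((a , b) ∷ ps) i j with isPair? a b i j
  ... | yes p  = inj₂ (target-entry (updates ps) p)
  ... | no ¬p = ⊎.map (trans (setPair-off (updates ps) ¬p)) (trans (setPair-off (updates ps) ¬p)) (updates-entry ps i j)
  updates-complete : ∀ ps {i j} → (i , j) ∈ ps → updates ps i j ≡ M′ i j
  updates-complete ((a , b) ∷ ps) (here refl) = target-entry (updates ps) (inj₁ (refl , refl))
  updates-complete ((a , b) ∷ ps) {i} {j} (there ij∈ps) with isPair? a b i j
  ... | yes p  = target-entry (updates ps) p
  ... | no ¬p = trans (setPair-off (updates ps) ¬p) (updates-complete ps ij∈ps)
  det-updates : ∀ ps → det (updates ps) ≈ det M mod + 4
  det-updates []             = ≡⇒≈-mod refl
  det-updates ((a , b) ∷ ps) = ≈-mod-trans (step (a ≟ b)) (det-updates ps)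
    where
    step : Dec (a ≡ b) → det (setPair (updates ps) a b (M′ a b)) ≈ det (updates ps) mod + 4
    step (yes refl) with updates-entry ps a a
    ... | inj₁ e = ≡⇒≈-mod (det-cong (setPair-unchanged (updates ps) (updates-symmetric ps) (trans (diag a) (sym e))))
    ... | inj₂ e = ≡⇒≈-mod (det-cong (setPair-unchanged (updates ps) (updates-symmetric ps) (sym e)))
    step (no a≢b) with updates-entry ps a b
    ... | inj₁ e = det-setPair (updates ps) (updates-symmetric ps) a≢b (subst (λ z → M′ a b ≈ z mod + 2) (sym e) (off a b))
    ... | inj₂ e = det-setPair (updates ps) (updates-symmetric ps) a≢b (≡⇒≈-mod (sym e))

permMatrix-on : ∀ {n} (σ : Permutation′ n) {i k} → i ≡ σ ⟨$⟩ʳ k → permMatrix σ i k ≡ + 1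
permMatrix-on σ {i} {k} e = cong (λ c → if c then + 1 else + 0) (dec-true (i ≟ σ ⟨$⟩ʳ k) e)

permMatrix-off : ∀ {n} (σ : Permutation′ n) {i k} → i ≢ σ ⟨$⟩ʳ k → permMatrix σ i k ≡ + 0
permMatrix-off σ {i} {k} ne = cong (λ c → if c then + 1 else + 0) (dec-false (i ≟ σ ⟨$⟩ʳ k) ne)

∑-permMatrix : ∀ {n} (σ : Permutation′ n) i (f : Fin n → ℤ) → ∑ (λ k → permMatrix σ i k * f k) ≡ f (σ ⟨$⟩ˡ i)
∑-permMatrix {ℕ.suc m} σ i f = begin
  ∑ (λ k → permMatrix σ i k * f k)                                  ≡⟨ ∑-remove j (λ k → permMatrix σ i k * f k) ⟩
  permMatrix σ i j * f j + ∑ (λ c → permMatrix σ i (punchIn j c) * f (punchIn j c))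
    ≡⟨ cong₂ _+_ (cong (_* f j) (permMatrix-on σ {i} (sym (inverseʳ σ)))) (∑-zero vanish) ⟩
  + 1 * f j + + 0                                                   ≡⟨ trans (ℤ.+-identityʳ _) (ℤ.*-identityˡ (f j)) ⟩
  f j                                                               ∎
  where
  open ≡-Reasoning
  j = σ ⟨$⟩ˡ i
  vanish : ∀ c → permMatrix σ i (punchIn j c) * f (punchIn j c) ≡ + 0
  vanish c = trans
    (cong (_* f (punchIn j c)) (permMatrix-off σ {i} (λ e → punchInᵢ≢i j c (sym (trans (cong (σ ⟨$⟩ˡ_) e) (inverseˡ σ))))))
    (ℤ.*-zeroˡ (f (punchIn j c)))

permMatrix-conj : ∀ {n} (σ : Permutation′ n) (B : Mat n) i j →
                  ((permMatrix σ · B) · transpose (permMatrix σ)) i j ≡ B (σ ⟨$⟩ˡ i) (σ ⟨$⟩ˡ j)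
permMatrix-conj σ B i j = begin
  ∑ (λ l → ∑ (λ k → permMatrix σ i k * B k l) * permMatrix σ j l)
    ≡⟨ ∑-cong (λ l → trans (cong (_* permMatrix σ j l) (∑-permMatrix σ i (λ k → B k l)))
                          (ℤ.*-comm _ (permMatrix σ j l))) ⟩
  ∑ (λ l → permMatrix σ j l * B (σ ⟨$⟩ˡ i) l)   ≡⟨ ∑-permMatrix σ j (B (σ ⟨$⟩ˡ i)) ⟩
  B (σ ⟨$⟩ˡ i) (σ ⟨$⟩ˡ j)                       ∎
  where open ≡-Reasoning

V-diag : ∀ {n} (X : Mat n) i → V X i i ≡ + 1
V-diag X i = trans
  (cong (λ c → if c then X i i else (if does (i ≟ i) then + 1 else + 0)) (dec-false (i <? i) (<-irrefl refl)))
  (cong (λ c → if c then + 1 else + 0) (dec-true (i ≟ i) refl))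

V-< : ∀ {n} (X : Mat n) {i j} → i < j → V X i j ≡ X i j
V-< X {i} {j} i<j = cong (λ c → if c then X i j else (if does (i ≟ j) then + 1 else + 0)) (dec-true (i <? j) i<j)

V-> : ∀ {n} (X : Mat n) {i j} → j < i → V X i j ≡ + 0
V-> X {i} {j} j<i = trans
  (cong (λ c → if c then X i j else (if does (i ≟ j) then + 1 else + 0)) (dec-false (i <? j) (<-asym j<i)))
  (cong (λ c → if c then + 1 else + 0) (dec-false (i ≟ j) (λ i≡j → <-irrefl (sym i≡j) j<i)))

𝔖-cong : ∀ {n} {X Y : Mat n} → (∀ i j → X i j ≡ Y i j) → ∀ i j → 𝔖 X i j ≡ 𝔖 Y i j
𝔖-cong {X = X} {Y} X≗Y i j = cong₂ _+_ (V-cong i j) (V-cong j i)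
  where
  V-cong : ∀ i j → V X i j ≡ V Y i j
  V-cong i j = cong (λ x → if does (i <? j) then x else (if does (i ≟ j) then + 1 else + 0)) (X≗Y i j)

𝔖-symmetric : ∀ {n} (X : Mat n) → Symmetric (𝔖 X)
𝔖-symmetric X i j = ℤ.+-comm (V X i j) (V X j i)

𝔖-diag : ∀ {n} (X : Mat n) i → 𝔖 X i i ≡ + 2
𝔖-diag X i = cong₂ _+_ (V-diag X i) (V-diag X i)

𝔖-offDiag : ∀ {n} {X : Mat n} → SkewSymmetric X → ∀ {i j} → i ≢ j → 𝔖 X i j ≈ X i j mod + 2
𝔖-offDiag {X = X} skew {i} {j} i≢j with <-cmp i j
... | tri< i<j _ _ = ≡⇒≈-mod (trans (cong₂ _+_ (V-< X i<j) (V-> X i<j)) (ℤ.+-identityʳ _))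
... | tri≈ _ i≡j _ = ⊥-elim (i≢j i≡j)
... | tri> _ _ j<i = congruent (X j i) (begin
  V X i j + V X j i       ≡⟨ cong₂ _+_ (V-> X j<i) (V-< X j<i) ⟩
  + 0 + X j i             ≡⟨ ℤ.+-identityˡ _ ⟩
  X j i                   ≡⟨ solve 1 (λ x → x := :- x :+ x :* con (+ 2)) refl (X j i) ⟩
  - X j i + X j i * + 2   ≡⟨ cong (λ z → - z + X j i * + 2) (skew j i) ⟩
  - - X i j + X j i * + 2 ≡⟨ cong (_+ X j i * + 2) (ℤ.neg-involutive (X i j)) ⟩
  X i j + X j i * + 2     ∎)
  where open ≡-Reasoning

lemma1p5 : (n : ℕ) (B : Mat n) → SkewSymmetric B → (σ : Permutation′ n) →
    δ ((permMatrix σ · B) · transpose (permMatrix σ)) ≡ δ B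
lemma1p5 n B skew σ =
  trans (cong (_%ℕ 4) (trans conjugate relabel)) (%ℕ-cong 4 (det-≈-mod4 (𝔖-symmetric B) symE diagE offE))
  where
  C E : Mat n
  C i j = B (σ ⟨$⟩ˡ i) (σ ⟨$⟩ˡ j)
  E a b = 𝔖 C (σ ⟨$⟩ʳ a) (σ ⟨$⟩ʳ b)
  conjugate : det (𝔖 ((permMatrix σ · B) · transpose (permMatrix σ))) ≡ det (𝔖 C)
  conjugate = det-cong (𝔖-cong (permMatrix-conj σ B))
  relabel : det (𝔖 C) ≡ det E
  relabel = sym (det-conj-permutation σ (𝔖 C))
  symE : Symmetric E
  symE a b = 𝔖-symmetric C (σ ⟨$⟩ʳ a) (σ ⟨$⟩ʳ b)
  diagE : ∀ a → E a a ≡ 𝔖 B a a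
  diagE a = trans (𝔖-diag C (σ ⟨$⟩ʳ a)) (sym (𝔖-diag B a))
  σ-injective : ∀ {a b} → σ ⟨$⟩ʳ a ≡ σ ⟨$⟩ʳ b → a ≡ b
  σ-injective e = trans (sym (inverseˡ σ)) (trans (cong (σ ⟨$⟩ˡ_) e) (inverseˡ σ))
  C-relabelled : ∀ a b → C (σ ⟨$⟩ʳ a) (σ ⟨$⟩ʳ b) ≡ B a b
  C-relabelled a b = cong₂ B (inverseˡ σ) (inverseˡ σ)
  offE′ : ∀ {a b} → Dec (a ≡ b) → E a b ≈ 𝔖 B a b mod + 2
  offE′ {a} (yes refl) = ≡⇒≈-mod (diagE a)
  offE′ {a} {b} (no a≢b) = ≈-mod-trans
    (𝔖-offDiag (λ i j → skew (σ ⟨$⟩ˡ i) (σ ⟨$⟩ˡ j)) (a≢b ∘ σ-injective))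
    (subst (λ z → z ≈ 𝔖 B a b mod + 2) (sym (C-relabelled a b)) (≈-mod-sym (𝔖-offDiag skew a≢b)))
  offE : ∀ a b → E a b ≈ 𝔖 B a b mod + 2
  offE a b = offE′ (a ≟ b)
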